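{- Let $n,k$ be integers with $2\le 2k\le n-4$. Let $\eta=(\eta_1<\dots<\eta_l)\in\overline{\mathbb{D}}^{\,\mathrm{o}}_{2k+2}$ and let $Y_{\eta^*}$ be the Young diagram whose main diagonal consists of exactly the $l+1$ cells $c_{1,1},\dots,c_{l+1,l+1}$ with $h_{1,1}=2n-5$, $h_{i,i}=\eta_{l-(i-2)}$ ($2\le i\le l+1$) and $a(c_{i,i})=l(c_{i,i})$ ($1\le i\le l+1$). Then every cell $c_{i,j}$ of $Y_{\eta^*}$ with $i,j\ge2$ satisfies $h_{i,j}<n-2$.
   Context: $\mathbb{D}^{\,\mathrm{o}}_N$ is the set of partitions of $N$ into distinct odd parts with at least two parts. $\overline{\mathbb{D}}^{\,\mathrm{o}}_{2k+2}=\mathbb{D}^{\,\mathrm{o}}_{2k+2}\setminus\{(1,2k+1)\}$ if $2k=n-4$, and $=\mathbb{D}^{\,\mathrm{o}}_{2k+2}$ otherwise. Young diagrams in English convention; $c_{i,j}$ is the cell in row $i$, column $j$; arm $a$ = cells to the right, leg $l$ = cells below, $h_{i,j}=a(c_{i,j})+l(c_{i,j})+1$. -}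

module Defs where

open import Data.Nat using (ℕ; zero; suc; _+_; _*_; _∸_; _≤_; _<_; _≥_; _≤ᵇ_)
open import Data.List using (List; []; _∷_; length)
open import Data.Nat.ListAction using (sum)
open import Data.List.Relation.Unary.All using (All)
open import Data.List.Relation.Unary.Linked using (Linked)
open import Data.Product using (Σ; _×_)
open import Data.Bool using (if_then_else_)
open import Relation.Binary.PropositionalEquality using (_≡_; _≢_)

Odd : ℕ → Set
Odd x = Σ ℕ (λ m → x ≡ 1 + 2 * m)

-- 1-indexed lookup in a list; 0 outside the range.
nth : List ℕ → ℕ → ℕ
nth []       _             = 0
nth (x ∷ xs) zero          = 0
nth (x ∷ xs) (suc zero)    = x
nth (x ∷ xs) (suc (suc i)) = nth xs (suc i)

-- Partition (Young diagram), given by its row lengths: positive, weakly decreasing.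
IsPartition : List ℕ → Set
IsPartition λs = All (λ x → 0 < x) λs × Linked _≥_ λs

rowLen : List ℕ → ℕ → ℕ
rowLen = nth

colLen : List ℕ → ℕ → ℕ
colLen []       j = 0
colLen (r ∷ rs) j = (if j ≤ᵇ r then 1 else 0) + colLen rs j

-- Cell c_{i,j} belongs to the diagram (English convention, 1-indexed).
InDiagram : List ℕ → ℕ → ℕ → Set
InDiagram λs i j = 1 ≤ i × 1 ≤ j × j ≤ rowLen λs i

arm : List ℕ → ℕ → ℕ → ℕ
arm λs i j = rowLen λs i ∸ j

leg : List ℕ → ℕ → ℕ → ℕ
leg λs i j = colLen λs j ∸ i

hook : List ℕ → ℕ → ℕ → ℕ
hook λs i j = arm λs i j + leg λs i j + 1

InDo : ℕ → List ℕ → Set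
InDo N η = Linked _<_ η × All Odd η × sum η ≡ N × 2 ≤ length η

-- The set \overline{D}^o_{2k+2} (depending on n): D^o_{2k+2}, with (1,2k+1)
-- removed when 2k = n-4.
InDoBar : ℕ → ℕ → List ℕ → Set
InDoBar n k η = InDo (2 * k + 2) η × (2 * k + 4 ≡ n → η ≢ 1 ∷ (2 * k + 1) ∷ [])

{-# OPTIONS --safe #-}
-- Hook lengths weakly decrease when moving down or to the right, so every hook
-- with i, j ≥ 2 is at most h_{2,2} = η_l, the largest part of η. Since η has a
-- positive part besides η_l, we get η_l < |η| = 2k + 2 ≤ n − 2.
module Submission where

open import Defs
open import Data.Nat using (ℕ; zero; suc; _+_; _*_; _∸_; _≤_; _<_; _≥_; z≤n; s≤s)
open import Data.Nat.Properties
open import Data.Nat.ListAction using (sum)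
open import Data.List using (List; []; _∷_; length)
open import Data.List.Relation.Unary.All as All using (All; _∷_)
open import Data.List.Relation.Unary.Linked using (Linked; _∷_)
open import Data.Product using (_,_)
open import Data.Bool using (Bool; true; false; if_then_else_; T)
open import Data.Unit using (tt)
open import Data.Empty using (⊥-elim)
open import Function using (_∘_)
open import Relation.Binary.PropositionalEquality using (_≡_; refl; cong)
open import Relation.Nullary using (¬_)

odd⇒positive : ∀ {x} → Odd x → 0 < x
odd⇒positive (_ , refl) = s≤s z≤n

nth≤head : ∀ {x xs} → Linked _≥_ (x ∷ xs) → ∀ i → nth (x ∷ xs) i ≤ x
nth≤head _ zero       = z≤n
nth≤head _ (suc zero) = ≤-refl
nth≤head {xs = []}    _          (suc (suc _)) = z≤n
nth≤head {xs = _ ∷ _} (x≥y ∷ ys) (suc (suc i)) = ≤-trans (nth≤head ys (suc i)) x≥y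

nth-antitone : ∀ {xs} → Linked _≥_ xs → ∀ {i j} → 1 ≤ i → i ≤ j → nth xs j ≤ nth xs i
nth-antitone {[]}        _ _ _ = z≤n
nth-antitone {_ ∷ _}     xs {suc zero} {j} _ _ = nth≤head xs j
nth-antitone {_ ∷ []}    _  {suc (suc _)} _ (s≤s (s≤s _)) = z≤n
nth-antitone {_ ∷ _ ∷ _} (_ ∷ xs) {suc (suc _)} {suc (suc _)} _ (s≤s i≤j) =
  nth-antitone xs (s≤s z≤n) i≤j

indicator-mono : ∀ {b c : Bool} → (T b → T c) → (if b then 1 else 0) ≤ (if c then 1 else 0)
indicator-mono {false}         _   = z≤n
indicator-mono {true} {true}   _   = ≤-refl
indicator-mono {true} {false} b⇒c = ⊥-elim (b⇒c tt)

colLen-antitone : ∀ rs {j j'} → j ≤ j' → colLen rs j' ≤ colLen rs j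
colLen-antitone []       _    = z≤n
colLen-antitone (r ∷ rs) {j} {j'} j≤j' =
  +-mono-≤ (indicator-mono (≤⇒≤ᵇ ∘ ≤-trans j≤j' ∘ ≤ᵇ⇒≤ j' r)) (colLen-antitone rs j≤j')

hook-antitone : ∀ {Y} → Linked _≥_ Y → ∀ {i j i' j'} → 1 ≤ i → i ≤ i' → j ≤ j' →
                hook Y i' j' ≤ hook Y i j
hook-antitone {Y} rows 1≤i i≤i' j≤j' = +-monoˡ-≤ 1 (+-mono-≤
  (∸-mono (nth-antitone rows 1≤i i≤i') j≤j')
  (∸-mono (colLen-antitone Y j≤j') i≤i'))

last≤sum : ∀ xs → nth xs (length xs) ≤ sum xs
last≤sum []           = z≤n
last≤sum (x ∷ [])     = m≤m+n x 0
last≤sum (x ∷ y ∷ ys) = ≤-trans (last≤sum (y ∷ ys)) (m≤n+m _ x)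

last<sum : ∀ {xs} → All (0 <_) xs → 2 ≤ length xs → nth xs (length xs) < sum xs
last<sum {_ ∷ []}     _         (s≤s ())
last<sum {_ ∷ y ∷ ys} (0<x ∷ _) _ = +-mono-≤ 0<x (last≤sum (y ∷ ys))

lemma4p11 : (n k : ℕ) → 2 ≤ 2 * k → 2 * k + 4 ≤ n →
    (η : List ℕ) → InDoBar n k η →
    (Y : List ℕ) → IsPartition Y →
    (∀ i → 1 ≤ i → i ≤ length η + 1 → InDiagram Y i i) →
    ¬ InDiagram Y (length η + 2) (length η + 2) →
    hook Y 1 1 ≡ 2 * n ∸ 5 →
    (∀ i → 2 ≤ i → i ≤ length η + 1 → hook Y i i ≡ nth η (length η + 2 ∸ i)) →
    (∀ i → 1 ≤ i → i ≤ length η + 1 → arm Y i i ≡ leg Y i i) →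
    ∀ i j → 2 ≤ i → 2 ≤ j → InDiagram Y i j → hook Y i j < n ∸ 2
lemma4p11 n k _ 2k+4≤n η ((_ , odd , sum≡ , 2≤l) , _) Y (_ , rows) _ _ _ hook-diag _
          i j 2≤i 2≤j _ = begin-strict
  hook Y i j                     ≤⟨ hook-antitone rows (s≤s z≤n) 2≤i 2≤j ⟩
  hook Y 2 2                     ≡⟨ hook-diag 2 ≤-refl (m≤n⇒m≤n+o 1 2≤l) ⟩
  nth η (length η + 2 ∸ 2)       ≡⟨ cong (nth η) (m+n∸n≡m (length η) 2) ⟩
  nth η (length η)               <⟨ last<sum (All.map odd⇒positive odd) 2≤l ⟩
  sum η                          ≡⟨ sum≡ ⟩
  2 * k + 2                      ≤⟨ m+n≤o⇒m≤o∸n (2 * k + 2) 2k+2+2≤n ⟩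
  n ∸ 2                          ∎
  where
  open ≤-Reasoning
  2k+2+2≤n : 2 * k + 2 + 2 ≤ n
  2k+2+2≤n = ≤-trans (≤-reflexive (+-assoc (2 * k) 2 2)) 2k+4≤n
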